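{- Let $D$ be a normal binary delta-matroid whose intersection graph $G_D$ is a complete graph on $v$ vertices. Then ${}^{\partial}w_{D}(z)=2^{v}z^{v-1}$ if $v$ is odd, and ${}^{\partial}w_{D}(z)=2^{v-1}z^{v}+2^{v-1}z^{v-2}$ if $v$ is even.
   Context: A delta-matroid is a pair $D=(E,\mathcal{F})$, $E$ finite, $\mathcal{F}$ a nonempty family of subsets of $E$ such that for all $X,Y\in\mathcal{F}$ and $u\in X\Delta Y$ there is $v\in X\Delta Y$ (possibly $v=u$) with $X\Delta\{u,v\}\in\mathcal{F}$. Twist: $D*A=(E,\{A\Delta X: X\in\mathcal{F}\})$; width $w(D)$: maximum minus minimum cardinality of a feasible set; twist polynomial ${}^{\partial}w_{D}(z)=\sum_{A\subseteq E} z^{w(D*A)}$. For a symmetric matrix $C$ over $GF(2)$ indexed by $E$, $D(C)=(E,\{A\subseteq E: C[A]\text{ nonsingular}\})$ ($C[\emptyset]$ nonsingular by convention). A normal binary delta-matroid is one of the form $D=D(C)$; $C$ is uniquely determined by $D$. The intersection graph $G_D$ has vertex set $E$, distinct $u,v$ adjacent iff $C_{u,v}=1$, and a loop at $u$ iff $C_{u,u}=1$; "complete graph" means simple complete graph (no loops). -}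

module Defs where

open import Data.Bool using (Bool; true; false; _∧_; _xor_; if_then_else_)
open import Data.Nat using (ℕ; zero; suc; _∸_; _⊔_; _⊓_; _≟_)
open import Data.Fin using (Fin; zero; suc)
open import Data.Fin.Subset using (Subset; ∣_∣)
open import Data.List using (List; []; _∷_; _++_; [_]; map; foldr; length)
open import Data.Vec using (Vec; []; _∷_; zipWith)
open import Relation.Nullary using (does)

-- Univariate polynomials with natural-number coefficients, represented by
-- their coefficient function: (p k) is the coefficient of z^k.
Poly : Set
Poly = ℕ → ℕ

mono : ℕ → ℕ → Poly
mono c d k = if does (k ≟ d) then c else 0

_⊕_ : Poly → Poly → Poly
(p ⊕ q) k = p k Data.Nat.+ q k

bfilter : ∀ {A : Set} → (A → Bool) → List A → List A
bfilter p [] = []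
bfilter p (x ∷ xs) = if p x then x ∷ bfilter p xs else bfilter p xs

allSubsets : (n : ℕ) → List (Subset n)
allSubsets zero = [ [] ]
allSubsets (suc n) = map (true ∷_) (allSubsets n) ++ map (false ∷_) (allSubsets n)

_Δ_ : ∀ {n} → Subset n → Subset n → Subset n
_Δ_ = zipWith _xor_

elems : ∀ {n} → Subset n → List (Fin n)
elems [] = []
elems (true ∷ p) = zero ∷ map suc (elems p)
elems (false ∷ p) = map suc (elems p)

-- Square matrices over GF(2) (Bool with xor as +, ∧ as *), indexed by Fin n.
Mat : ℕ → Set
Mat n = Fin n → Fin n → Bool

-- Determinant over GF(2) of the submatrix of M with rows rs and columns cs
-- (in the given orders), by Laplace expansion along the first row
-- (signs are irrelevant in characteristic 2).  det of the 0×0 matrix is 1.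
mutual
  detSub : ∀ {n} → Mat n → List (Fin n) → List (Fin n) → Bool
  detSub M [] [] = true
  detSub M [] (_ ∷ _) = false
  detSub M (i ∷ rs) cs = expand M i rs [] cs

  -- sum over choices of column j (cs = pre ++ j ∷ post) of M i j * det(minor)
  expand : ∀ {n} → Mat n → Fin n → List (Fin n) → List (Fin n) → List (Fin n) → Bool
  expand M i rs pre [] = false
  expand M i rs pre (j ∷ post) =
    (M i j ∧ detSub M rs (pre ++ post)) xor expand M i rs (pre ++ [ j ]) post

nonsingular : ∀ {n} → Mat n → Subset n → Bool
nonsingular C A = detSub C (elems A) (elems A)

-- feasible sets of the normal binary delta-matroid D(C)
feasibleD : ∀ {n} → Mat n → List (Subset n)
feasibleD {n} C = bfilter (nonsingular C) (allSubsets n)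

twist : ∀ {n} → List (Subset n) → Subset n → List (Subset n)
twist F A = map (A Δ_) F

-- width of a set system: max cardinality minus min cardinality
-- (0 for the empty family, which never occurs for delta-matroids)
width : ∀ {n} → List (Subset n) → ℕ
width [] = 0
width (X ∷ Xs) = foldr (λ Y m → ∣ Y ∣ ⊔ m) (∣ X ∣) Xs ∸ foldr (λ Y m → ∣ Y ∣ ⊓ m) (∣ X ∣) Xs

-- twist polynomial  ∂w_D(z) = Σ_{A ⊆ E} z^{w(D*A)}  of a delta-matroid given
-- by its list of feasible sets; coefficient of z^k = #{A : w(D*A) = k}
twistPoly : ∀ {n} → List (Subset n) → Poly
twistPoly {n} F k = length (bfilter (λ A → does (width (twist F A) ≟ k)) (allSubsets n))

module Submission where

-- Over GF(2) the matrix of D is C = J − I, and the principal submatrix on A is J − I of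
-- size |A|, whose determinant is 1 + |A|; hence the feasible sets of D are exactly the
-- subsets of even size.  Since nonsingularity is defined by Laplace expansion, this is
-- proved for every minor of J − I with distinct rows R and distinct columns K: its
-- determinant depends only on |R| and on the number of columns outside R, and the
-- expansion along the first row is a recurrence in these two numbers.
--
-- Twisting the even sets by A gives all sets Y with |Y| ≡ |A| (mod 2), so w(D*A) is the
-- difference between the largest and the smallest size of such a set: v − 1 if v is odd,
-- and v or v − 2 if v is even, according as |A| is even or odd.  Exactly 2^(v−1) subsets
-- A have each parity.

open import Algebra.Bundles using (CommutativeRing)
open import Data.Bool using (Bool; true; false; not; _∧_; _xor_; if_then_else_)
open import Data.Bool.Properties
  using ( not-involutive; not-injective; ¬-not; ∧-zeroʳ; ∧-identityʳ; xor-assoc; xor-same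
        ; xor-identityʳ; xor-inverseʳ; not-distribˡ-xor; not-distribʳ-xor; xor-∧-commutativeRing)
open import Data.Fin using (Fin; zero; suc)
import Data.Fin.Properties as Finₚ
open import Data.Fin.Subset using (Subset; ∣_∣; ⊥)
open import Data.Fin.Subset.Properties using (∣⊥∣≡0; ∣p∣≤n)
open import Data.List using (List; []; _∷_; _++_; [_]; length; map; filter; foldr)
open import Data.List.Properties
  using ( length-++; length-map; ++-assoc; filter-none; filter-some; length-removeAt′
        ; foldr-map; foldr-preservesᵇ; foldr-preservesᵒ)
open import Data.List.Membership.Propositional using (_∈_; _∉_)
open import Data.List.Membership.Propositional.Properties using (∈-map⁺; ∈-map⁻; ∈-++⁺ˡ; ∈-++⁺ʳ)
open import Data.List.Relation.Binary.Permutation.Propositional.Properties using (↭-length; filter-↭; shift)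
open import Data.List.Relation.Unary.All as All using (All; []; _∷_)
import Data.List.Relation.Unary.All.Properties as Allₚ
open import Data.List.Relation.Unary.Any as Any using (here; there; index; _─_)
open import Data.List.Relation.Unary.Unique.Propositional using (Unique; []; _∷_)
import Data.List.Relation.Unary.Unique.Propositional.Properties as Uniqueₚ
open import Data.Nat using (ℕ; zero; suc; pred; _+_; _*_; _^_; _∸_; _⊔_; _⊓_; _≤_; _<_; z≤n; s≤s; _≟_)
import Data.Nat.Properties as ℕ
open import Data.Nat.Properties
  using ( +-comm; +-suc; +-identityʳ; ≤-refl; ≤-reflexive; ≤-trans; ≤-antisym; ≤∧≢⇒<; <⇒≤pred
        ; pred[n]≤n; n≮n; ⊔-lub; ⊓-glb; m≤n⇒m≤n⊔o; m≤n⇒m≤o⊔n; m≤n⇒m⊓o≤n; m≤n⇒o⊓m≤n)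
open import Data.Nat.Divisibility using (_∣_; divides)
open import Data.Product using (Σ; _×_; _,_; proj₁; proj₂)
open import Data.Sum as Sum using (_⊎_; inj₁; inj₂)
open import Data.Vec using ([]; _∷_)
open import Function using (_∘_)
open import Function.Bundles using (_⇔_; mk⇔; Equivalence)
open import Level using (Level)
open import Relation.Binary.PropositionalEquality
  using (_≡_; _≢_; refl; sym; trans; cong; cong₂; subst; module ≡-Reasoning)
open import Relation.Nullary using (¬_; yes; no; does; contradiction)
open import Relation.Nullary.Decidable using (dec-false)
open import Relation.Unary using (Pred; Decidable)
open import Relation.Unary.Properties using (∁?)
open import Algebra.Properties.CommutativeSemigroup
  (CommutativeRing.+-commutativeSemigroup xor-∧-commutativeRing)
  using () renaming (interchange to xor-interchange; x∙yz≈y∙xz to xor-x∙yz≈y∙xz)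

open import Defs

private
  variable
    a p : Level
    A : Set a

odd : ℕ → Bool
odd zero = false
odd (suc n) = not (odd n)

odd[q*2]≡false : ∀ q → odd (q * 2) ≡ false
odd[q*2]≡false zero = refl
odd[q*2]≡false (suc q) = trans (not-involutive (odd (q * 2))) (odd[q*2]≡false q)

2∣⇒odd≡false : ∀ {m} → 2 ∣ m → odd m ≡ false
2∣⇒odd≡false (divides q refl) = odd[q*2]≡false q

odd≡false⇒2∣ : ∀ m → odd m ≡ false → 2 ∣ m
odd≡false⇒2∣ zero _ = divides 0 refl
odd≡false⇒2∣ (suc (suc m)) even with odd≡false⇒2∣ m (trans (sym (not-involutive (odd m))) even)
... | divides q m≡q*2 = divides (suc q) (cong (2 +_) m≡q*2)

¬2∣⇒odd≡true : ∀ m → ¬ 2 ∣ m → odd m ≡ true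
¬2∣⇒odd≡true m ¬2∣m = ¬-not (¬2∣m ∘ odd≡false⇒2∣ m)

m+1≡1+n⇒m≡n : ∀ {m n} → m + 1 ≡ suc n → m ≡ n
m+1≡1+n⇒m≡n {m} m+1≡1+n = ℕ.suc-injective (trans (+-comm 1 m) m+1≡1+n)

xor-∧-flip : ∀ x y → y xor (x ∧ y) ≡ not x ∧ y
xor-∧-flip true y = xor-same y
xor-∧-flip false y = xor-identityʳ y

xor-cancelˡ : ∀ x y → x xor (x xor y) ≡ y
xor-cancelˡ x y = trans (sym (xor-assoc x x y)) (cong (_xor y) (xor-same x))

xor≡false⇔≡ : ∀ x y → x xor y ≡ false ⇔ y ≡ x
xor≡false⇔≡ x y = mk⇔
  (λ x⊕y≡0 → trans (sym (xor-cancelˡ x y)) (trans (cong (x xor_) x⊕y≡0) (xor-identityʳ x)))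
  (λ { refl → xor-same x })

length-filter-∁ : ∀ {P : Pred A p} (P? : Decidable P) xs →
  length (filter P? xs) + length (filter (∁? P?) xs) ≡ length xs
length-filter-∁ P? [] = refl
length-filter-∁ P? (x ∷ xs) with P? x
... | yes _ = cong suc (length-filter-∁ P? xs)
... | no _ = trans (+-suc _ _) (cong suc (length-filter-∁ P? xs))

∈-─ : ∀ {x y} {xs : List A} (x∈xs : x ∈ xs) → y ∈ xs → x ≢ y → y ∈ (xs ─ x∈xs)
∈-─ (here refl) (here refl) x≢y = contradiction refl x≢y
∈-─ (here _) (there y∈xs) _ = y∈xs
∈-─ (there _) (here refl) _ = here refl
∈-─ (there x∈xs) (there y∈xs) x≢y = there (∈-─ x∈xs y∈xs x≢y)

Unique-⊆⇒length≤ : ∀ {xs ys : List A} → Unique xs → All (_∈ ys) xs → length xs ≤ length ys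
Unique-⊆⇒length≤ [] [] = z≤n
Unique-⊆⇒length≤ {ys = ys} (x≢xs ∷ uxs) (x∈ys ∷ xs⊆ys) =
  subst (_ ≤_) (sym (length-removeAt′ ys (index x∈ys)))
    (s≤s (Unique-⊆⇒length≤ uxs (All.zipWith (λ (x≢y , y∈ys) → ∈-─ x∈ys y∈ys x≢y) (x≢xs , xs⊆ys))))

Unique-dropMiddle : ∀ xs {y} {ys : List A} → Unique (xs ++ y ∷ ys) → Unique (xs ++ ys)
Unique-dropMiddle [] (_ ∷ u) = u
Unique-dropMiddle (x ∷ xs) (x≢ ∷ u) with Allₚ.++⁻ xs x≢
... | x≢xs , _ ∷ x≢ys = Allₚ.++⁺ x≢xs x≢ys ∷ Unique-dropMiddle xs u

∈-bfilter⁺ : ∀ {X : Set} (q : X → Bool) {x xs} → x ∈ xs → q x ≡ true → x ∈ bfilter q xs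
∈-bfilter⁺ q {xs = y ∷ ys} (here refl) qx rewrite qx = here refl
∈-bfilter⁺ q {xs = y ∷ ys} (there x∈ys) qx with q y
... | true = there (∈-bfilter⁺ q x∈ys qx)
... | false = ∈-bfilter⁺ q x∈ys qx

∈-bfilter⁻ : ∀ {X : Set} (q : X → Bool) {x} xs → x ∈ bfilter q xs → q x ≡ true
∈-bfilter⁻ q (y ∷ ys) x∈ with q y in qy
∈-bfilter⁻ q (y ∷ ys) (here refl) | true = qy
∈-bfilter⁻ q (y ∷ ys) (there x∈) | true = ∈-bfilter⁻ q ys x∈
∈-bfilter⁻ q (y ∷ ys) x∈ | false = ∈-bfilter⁻ q ys x∈

bfilter-cong : ∀ {X : Set} {q r : X → Bool} → (∀ x → q x ≡ r x) → ∀ xs → bfilter q xs ≡ bfilter r xs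
bfilter-cong q≗r [] = refl
bfilter-cong {r = r} q≗r (x ∷ xs) rewrite q≗r x with r x
... | true = cong (x ∷_) (bfilter-cong q≗r xs)
... | false = bfilter-cong q≗r xs

bfilter-++ : ∀ {X : Set} (q : X → Bool) xs ys → bfilter q (xs ++ ys) ≡ bfilter q xs ++ bfilter q ys
bfilter-++ q [] ys = refl
bfilter-++ q (x ∷ xs) ys with q x
... | true = cong (x ∷_) (bfilter-++ q xs ys)
... | false = bfilter-++ q xs ys

bfilter-map : ∀ {X Y : Set} (q : Y → Bool) (f : X → Y) xs → bfilter q (map f xs) ≡ map f (bfilter (q ∘ f) xs)
bfilter-map q f [] = refl
bfilter-map q f (x ∷ xs) with q (f x)
... | true = cong (f x ∷_) (bfilter-map q f xs)
... | false = bfilter-map q f xs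

length-bfilter-∁ : ∀ {X : Set} (q : X → Bool) xs →
  length (bfilter q xs) + length (bfilter (not ∘ q) xs) ≡ length xs
length-bfilter-∁ q [] = refl
length-bfilter-∁ q (x ∷ xs) with q x
... | true = cong suc (length-bfilter-∁ q xs)
... | false = trans (+-suc _ _) (cong suc (length-bfilter-∁ q xs))

length-bfilter-∘ : ∀ {X : Set} (g : Bool → Bool) (q : X → Bool) xs →
  length (bfilter (g ∘ q) xs) ≡
    (if g true then length (bfilter q xs) else 0) + (if g false then length (bfilter (not ∘ q) xs) else 0)
length-bfilter-∘ g q [] with g true | g false
... | true | true = refl
... | true | false = refl
... | false | true = refl
... | false | false = refl
length-bfilter-∘ g q (x ∷ xs) with q x
... | true with g true | length-bfilter-∘ g q xs
...   | true | ih = cong suc ih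
...   | false | ih = ih
length-bfilter-∘ g q (x ∷ xs) | false with g false | length-bfilter-∘ g q xs
...   | true | ih = trans (cong suc ih) (sym (+-suc _ _))
...   | false | ih = ih

Unique-elems : ∀ {n} (X : Subset n) → Unique (elems X)
Unique-elems [] = []
Unique-elems (true ∷ X) =
  Allₚ.map⁺ (All.universal (λ _ ()) (elems X)) ∷ Uniqueₚ.map⁺ Finₚ.suc-injective (Unique-elems X)
Unique-elems (false ∷ X) = Uniqueₚ.map⁺ Finₚ.suc-injective (Unique-elems X)

length-elems : ∀ {n} (X : Subset n) → length (elems X) ≡ ∣ X ∣
length-elems [] = refl
length-elems (true ∷ X) = cong suc (trans (length-map suc (elems X)) (length-elems X))
length-elems (false ∷ X) = trans (length-map suc (elems X)) (length-elems X)

∈-allSubsets : ∀ {n} (X : Subset n) → X ∈ allSubsets n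
∈-allSubsets [] = here refl
∈-allSubsets (true ∷ X) = ∈-++⁺ˡ (∈-map⁺ (true ∷_) (∈-allSubsets X))
∈-allSubsets (false ∷ X) = ∈-++⁺ʳ (map (true ∷_) (allSubsets _)) (∈-map⁺ (false ∷_) (∈-allSubsets X))

length-allSubsets : ∀ n → length (allSubsets n) ≡ 2 ^ n
length-allSubsets zero = refl
length-allSubsets (suc n) = begin
  length (map (true ∷_) (allSubsets n) ++ map (false ∷_) (allSubsets n))
    ≡⟨ length-++ (map (true ∷_) (allSubsets n)) ⟩
  length (map (true ∷_) (allSubsets n)) + length (map (false ∷_) (allSubsets n))
    ≡⟨ cong₂ _+_ (length-map (true ∷_) (allSubsets n)) (length-map (false ∷_) (allSubsets n)) ⟩
  length (allSubsets n) + length (allSubsets n)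
    ≡⟨ cong (λ k → k + k) (length-allSubsets n) ⟩
  2 ^ n + 2 ^ n
    ≡⟨ cong (2 ^ n +_) (sym (+-identityʳ (2 ^ n))) ⟩
  2 ^ suc n ∎
  where open ≡-Reasoning

subsetOfSize : ∀ {n k} → k ≤ n → Σ (Subset n) λ Y → ∣ Y ∣ ≡ k
subsetOfSize {n} {zero} _ = ⊥ , ∣⊥∣≡0 n
subsetOfSize (s≤s k≤n) = let Y , ∣Y∣≡k = subsetOfSize k≤n in (true ∷ Y) , cong suc ∣Y∣≡k

odd-∣∷∣ : ∀ {n} b (Y : Subset n) → odd ∣ b ∷ Y ∣ ≡ b xor odd ∣ Y ∣
odd-∣∷∣ true Y = refl
odd-∣∷∣ false Y = refl

odd-∣Δ∣ : ∀ {n} (X Y : Subset n) → odd ∣ X Δ Y ∣ ≡ odd ∣ X ∣ xor odd ∣ Y ∣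
odd-∣Δ∣ [] [] = refl
odd-∣Δ∣ (x ∷ X) (y ∷ Y) = begin
  odd ∣ (x xor y) ∷ X Δ Y ∣               ≡⟨ odd-∣∷∣ (x xor y) (X Δ Y) ⟩
  (x xor y) xor odd ∣ X Δ Y ∣             ≡⟨ cong ((x xor y) xor_) (odd-∣Δ∣ X Y) ⟩
  (x xor y) xor (odd ∣ X ∣ xor odd ∣ Y ∣) ≡⟨ xor-interchange x y (odd ∣ X ∣) (odd ∣ Y ∣) ⟩
  (x xor odd ∣ X ∣) xor (y xor odd ∣ Y ∣) ≡⟨ sym (cong₂ _xor_ (odd-∣∷∣ x X) (odd-∣∷∣ y Y)) ⟩
  odd ∣ x ∷ X ∣ xor odd ∣ y ∷ Y ∣         ∎
  where open ≡-Reasoning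

Δ-cancelˡ : ∀ {n} (X Y : Subset n) → X Δ (X Δ Y) ≡ Y
Δ-cancelˡ [] [] = refl
Δ-cancelˡ (x ∷ X) (y ∷ Y) = cong₂ _∷_ (xor-cancelˡ x y) (Δ-cancelˡ X Y)

-- Minors of J − I over GF(2)

-- The determinant of a minor of J − I of size m whose column list has d entries outside its
-- row list (rows and columns distinct).  Such columns are all-ones, so two of them make the
-- minor singular; for d = 0 the minor is J − P with P a permutation matrix, of determinant
-- 1 + m.
minorDet : ℕ → ℕ → Bool
minorDet m zero = not (odd m)
minorDet m (suc zero) = true
minorDet m (suc (suc _)) = false

minorDet-suc : ∀ m a D b → a + D ≡ suc m → 0 < D → D ≡ b ⊎ D ≡ suc b →
  minorDet (suc m) b ≡ (odd a ∧ minorDet m D) xor (odd b ∧ minorDet m (D ∸ 1))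
minorDet-suc m a _ zero a+1≡1+m _ (inj₂ refl)
  rewrite m+1≡1+n⇒m≡n a+1≡1+m | ∧-identityʳ (odd m) | xor-identityʳ (odd m) = not-involutive (odd m)
minorDet-suc m a _ (suc zero) _ _ (inj₂ refl) rewrite ∧-zeroʳ (odd a) = refl
minorDet-suc m a _ b@(suc (suc _)) _ _ (inj₂ refl) rewrite ∧-zeroʳ (odd a) | ∧-zeroʳ (odd b) = refl
minorDet-suc m a _ zero _ () (inj₁ refl)
minorDet-suc m a _ (suc zero) a+1≡1+m _ (inj₁ refl)
  rewrite m+1≡1+n⇒m≡n a+1≡1+m | ∧-identityʳ (odd m) = sym (xor-inverseʳ (odd m))
minorDet-suc m a _ (suc (suc zero)) _ _ (inj₁ refl) rewrite ∧-zeroʳ (odd a) = refl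
minorDet-suc m a _ b@(suc (suc (suc _))) _ _ (inj₁ refl) rewrite ∧-zeroʳ (odd a) | ∧-zeroʳ (odd b) = refl

module MinorsOfJ-I {n : ℕ} (M : Mat n)
  (M-diag : ∀ u → M u u ≡ false) (M-offDiag : ∀ u w → u ≢ w → M u w ≡ true) where

  open import Data.List.Membership.DecPropositional (Finₚ._≟_ {n}) using (_∈?_; _∉?_)

  inside outside : List (Fin n) → List (Fin n) → ℕ
  inside rs cs = length (filter (_∈? rs) cs)
  outside rs cs = length (filter (_∉? rs) cs)

  inside+outside : ∀ rs cs → inside rs cs + outside rs cs ≡ length cs
  inside+outside rs = length-filter-∁ (_∈? rs)

  outside-shift : ∀ rs pre j post → outside rs (pre ++ j ∷ post) ≡ outside rs (j ∷ pre ++ post)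
  outside-shift rs pre j post = ↭-length (filter-↭ (_∉? rs) (shift j pre post))

  outside-self : ∀ cs → outside cs cs ≡ 0
  outside-self cs = cong length (filter-none (_∉? cs) (All.tabulate λ c∈cs c∉cs → c∉cs c∈cs))

  outside-∉ : ∀ {i} rs cs → i ∉ cs → outside rs cs ≡ outside (i ∷ rs) cs
  outside-∉ rs [] _ = refl
  outside-∉ {i} rs (c ∷ cs) i∉ with c Finₚ.≟ i | c ∈? rs
  ... | yes refl | _ = contradiction (here refl) i∉
  ... | no _ | yes _ = outside-∉ rs cs (i∉ ∘ there)
  ... | no _ | no _ = cong suc (outside-∉ rs cs (i∉ ∘ there))

  outside-∷ : ∀ {i} rs cs → i ∉ rs → Unique cs →
    outside rs cs ≡ outside (i ∷ rs) cs ⊎ outside rs cs ≡ suc (outside (i ∷ rs) cs)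
  outside-∷ rs [] _ _ = inj₁ refl
  outside-∷ {i} rs (c ∷ cs) i∉rs uc@(_ ∷ ucs) with c Finₚ.≟ i | c ∈? rs
  ... | yes refl | yes i∈rs = contradiction i∈rs i∉rs
  ... | yes refl | no _ = inj₂ (cong suc (outside-∉ rs cs (Uniqueₚ.Unique[x∷xs]⇒x∉xs uc)))
  ... | no _ | yes _ = outside-∷ rs cs i∉rs ucs
  ... | no _ | no _ = Sum.map (cong suc) (cong suc) (outside-∷ rs cs i∉rs ucs)

  outside>0 : ∀ rs cs → Unique cs → length cs ≡ suc (length rs) → 0 < outside rs cs
  outside>0 rs cs ucs |cs| = filter-some (_∉? rs) (Allₚ.¬All⇒Any¬ (_∈? rs) cs cs⊈rs)
    where
    cs⊈rs : ¬ All (_∈ rs) cs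
    cs⊈rs cs⊆rs = n≮n _ (subst (_≤ length rs) |cs| (Unique-⊆⇒length≤ ucs cs⊆rs))

  module Expansion (i : Fin n) (rs : List (Fin n)) (i∉rs : i ∉ rs) where

    m : ℕ
    m = length rs

    -- The terms of the expansion along row i for the columns post, when the full column list
    -- has D entries outside rs: deleting a column inside rs leaves D such entries, deleting
    -- one outside rs (other than i, whose entry is 0) leaves D ∸ 1, and over GF(2) only the
    -- parities of the numbers of the two kinds of columns matter.
    laplace : ℕ → List (Fin n) → Bool
    laplace D post =
      (odd (inside rs post) ∧ minorDet m D) xor (odd (outside (i ∷ rs) post) ∧ minorDet m (D ∸ 1))

    laplace-∷ : ∀ j L post →
      (M i j ∧ minorDet m (outside rs L)) xor laplace (outside rs (j ∷ L)) post ≡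
        laplace (outside rs (j ∷ L)) (j ∷ post)
    laplace-∷ j L post with i Finₚ.≟ j | j Finₚ.≟ i | j ∈? rs
    ... | yes refl | _ | yes i∈rs = contradiction i∈rs i∉rs
    ... | yes refl | no i≢i | _ = contradiction refl i≢i
    ... | no i≢j | yes refl | _ = contradiction refl i≢j
    ... | yes refl | yes _ | no _ rewrite M-diag i = refl
    ... | no i≢j | no _ | yes _ rewrite M-offDiag i j i≢j =
      trans (sym (xor-assoc y (x ∧ y) z)) (cong (_xor z) (xor-∧-flip x y))
      where
      x y z : Bool
      x = odd (inside rs post)
      y = minorDet m (outside rs L)
      z = odd (outside (i ∷ rs) post) ∧ minorDet m (outside rs L ∸ 1)
    ... | no i≢j | no _ | no _ rewrite M-offDiag i j i≢j =
      trans (xor-x∙yz≈y∙xz y u (b ∧ y)) (cong (u xor_) (xor-∧-flip b y))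
      where
      u b y : Bool
      u = odd (inside rs post) ∧ minorDet m (suc (outside rs L))
      b = odd (outside (i ∷ rs) post)
      y = minorDet m (outside rs L)

    expand≡laplace :
      (∀ cs → Unique cs → length cs ≡ m → detSub M rs cs ≡ minorDet m (outside rs cs)) →
      ∀ {L} → Unique L → length L ≡ suc m →
      ∀ pre post → pre ++ post ≡ L → expand M i rs pre post ≡ laplace (outside rs L) post
    expand≡laplace det-rs uL |L| pre [] _ = refl
    expand≡laplace det-rs uL |L| pre (j ∷ post) refl = begin
      (M i j ∧ detSub M rs (pre ++ post)) xor expand M i rs (pre ++ [ j ]) post
        ≡⟨ cong₂ (λ d e → (M i j ∧ d) xor e) minor
             (expand≡laplace det-rs uL |L| (pre ++ [ j ]) post (++-assoc pre [ j ] post)) ⟩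
      (M i j ∧ minorDet m (outside rs (pre ++ post))) xor laplace (outside rs (pre ++ j ∷ post)) post
        ≡⟨ cong (λ D → (M i j ∧ minorDet m (outside rs (pre ++ post))) xor laplace D post)
                (outside-shift rs pre j post) ⟩
      (M i j ∧ minorDet m (outside rs (pre ++ post))) xor laplace (outside rs (j ∷ pre ++ post)) post
        ≡⟨ laplace-∷ j (pre ++ post) post ⟩
      laplace (outside rs (j ∷ pre ++ post)) (j ∷ post)
        ≡⟨ cong (λ D → laplace D (j ∷ post)) (sym (outside-shift rs pre j post)) ⟩
      laplace (outside rs (pre ++ j ∷ post)) (j ∷ post) ∎
      where
      open ≡-Reasoning
      minor : detSub M rs (pre ++ post) ≡ minorDet m (outside rs (pre ++ post))
      minor = det-rs (pre ++ post) (Unique-dropMiddle pre uL)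
                (ℕ.suc-injective (trans (sym (↭-length (shift j pre post))) |L|))

  detSub≡minorDet : ∀ rs cs → Unique rs → Unique cs → length cs ≡ length rs →
    detSub M rs cs ≡ minorDet (length rs) (outside rs cs)
  detSub≡minorDet [] [] _ _ _ = refl
  detSub≡minorDet (i ∷ rs) cs uirs@(_ ∷ urs) ucs |cs| = begin
    expand M i rs [] cs
      ≡⟨ expand≡laplace (λ cs′ → detSub≡minorDet rs cs′ urs) ucs |cs| [] cs refl ⟩
    laplace (outside rs cs) cs
      ≡⟨ sym (minorDet-suc (length rs) (inside rs cs) (outside rs cs) (outside (i ∷ rs) cs)
               (trans (inside+outside rs cs) |cs|) (outside>0 rs cs ucs |cs|) (outside-∷ rs cs i∉rs ucs)) ⟩
    minorDet (suc (length rs)) (outside (i ∷ rs) cs) ∎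
    where
    open ≡-Reasoning
    i∉rs : i ∉ rs
    i∉rs = Uniqueₚ.Unique[x∷xs]⇒x∉xs uirs
    open Expansion i rs i∉rs

  nonsingular≡even : (X : Subset n) → nonsingular M X ≡ not (odd ∣ X ∣)
  nonsingular≡even X = begin
    detSub M (elems X) (elems X)
      ≡⟨ detSub≡minorDet (elems X) (elems X) (Unique-elems X) (Unique-elems X) refl ⟩
    minorDet (length (elems X)) (outside (elems X) (elems X))
      ≡⟨ cong₂ minorDet (length-elems X) (outside-self (elems X)) ⟩
    not (odd ∣ X ∣) ∎
    where open ≡-Reasoning

-- Widths of parity classes

foldr-⊔≡ : ∀ {m} e ns → All (_≤ m) (e ∷ ns) → m ∈ e ∷ ns → foldr _⊔_ e ns ≡ m
foldr-⊔≡ e ns (e≤m ∷ ns≤m) m∈ = ≤-antisym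
  (foldr-preservesᵇ ⊔-lub e≤m ns≤m)
  (foldr-preservesᵒ (λ x y → Sum.[ m≤n⇒m≤n⊔o y , m≤n⇒m≤o⊔n x ]) e ns
    (Sum.map ≤-reflexive (Any.map ≤-reflexive) (Any.toSum m∈)))

foldr-⊓≡ : ∀ {m} e ns → All (m ≤_) (e ∷ ns) → m ∈ e ∷ ns → foldr _⊓_ e ns ≡ m
foldr-⊓≡ e ns (m≤e ∷ m≤ns) m∈ = ≤-antisym
  (foldr-preservesᵒ (λ x y → Sum.[ m≤n⇒m⊓o≤n y , m≤n⇒o⊓m≤n x ]) e ns
    (Sum.map (≤-reflexive ∘ sym) (Any.map (≤-reflexive ∘ sym)) (Any.toSum m∈)))
  (foldr-preservesᵇ ⊓-glb m≤e m≤ns)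

width≡ : ∀ {n} (L : List (Subset n)) {lo hi} → (∀ {Y} → Y ∈ L → lo ≤ ∣ Y ∣ × ∣ Y ∣ ≤ hi) →
  lo ∈ map ∣_∣ L → hi ∈ map ∣_∣ L → width L ≡ hi ∸ lo
width≡ (X ∷ Xs) bounds lo∈ hi∈ = cong₂ _∸_
  (trans (sym (foldr-map _⊔_ ∣_∣ ∣ X ∣ Xs)) (foldr-⊔≡ ∣ X ∣ (map ∣_∣ Xs) (sizes (proj₂ ∘ bounds)) hi∈))
  (trans (sym (foldr-map _⊓_ ∣_∣ ∣ X ∣ Xs)) (foldr-⊓≡ ∣ X ∣ (map ∣_∣ Xs) (sizes (proj₁ ∘ bounds)) lo∈))
  where
  sizes : ∀ {P : ℕ → Set} → (∀ {Y} → Y ∈ X ∷ Xs → P ∣ Y ∣) → All P (map ∣_∣ (X ∷ Xs))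
  sizes P-size = Allₚ.map⁺ (All.tabulate P-size)

smallestOfParity : Bool → ℕ
smallestOfParity q = if q then 1 else 0

largestOfParity : ℕ → Bool → ℕ
largestOfParity n q = if odd n xor q then pred n else n

odd-smallestOfParity : ∀ q → odd (smallestOfParity q) ≡ q
odd-smallestOfParity true = refl
odd-smallestOfParity false = refl

smallestOfParity-≤ : ∀ {k} q → odd k ≡ q → smallestOfParity q ≤ k
smallestOfParity-≤ false _ = z≤n
smallestOfParity-≤ {suc k} true _ = s≤s z≤n

odd-largestOfParity : ∀ n q → odd (largestOfParity (suc n) q) ≡ q
odd-largestOfParity n q with not (odd n) xor q in e
... | true = sym (Equivalence.to (xor≡false⇔≡ (odd n) q) (not-injective (trans (not-distribˡ-xor (odd n) q) e)))
... | false = sym (Equivalence.to (xor≡false⇔≡ (not (odd n)) q) e)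

largestOfParity-≤ : ∀ n q → largestOfParity n q ≤ n
largestOfParity-≤ n q with odd n xor q
... | true = pred[n]≤n
... | false = ≤-refl

≤-largestOfParity : ∀ {k} n q → k ≤ n → odd k ≡ q → k ≤ largestOfParity n q
≤-largestOfParity {k} n q k≤n refl with odd n xor odd k in e
... | true = <⇒≤pred (≤∧≢⇒< k≤n λ { refl → contradiction (trans (sym e) (xor-same (odd k))) λ () })
... | false = k≤n

width-parityClass : ∀ {n} (L : List (Subset (suc n))) q → (∀ {Y} → Y ∈ L ⇔ odd ∣ Y ∣ ≡ q) →
  width L ≡ largestOfParity (suc n) q ∸ smallestOfParity q
width-parityClass {n} L q L⇔q = width≡ L bounds
  (attained (≤-trans (smallestOfParity-≤ q (odd-largestOfParity n q)) (largestOfParity-≤ (suc n) q))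
            (odd-smallestOfParity q))
  (attained (largestOfParity-≤ (suc n) q) (odd-largestOfParity n q))
  where
  bounds : ∀ {Y} → Y ∈ L → smallestOfParity q ≤ ∣ Y ∣ × ∣ Y ∣ ≤ largestOfParity (suc n) q
  bounds {Y} Y∈L = let oddY = Equivalence.to (L⇔q {Y}) Y∈L in
    smallestOfParity-≤ q oddY , ≤-largestOfParity (suc n) q (∣p∣≤n Y) oddY
  attained : ∀ {k} → k ≤ suc n → odd k ≡ q → k ∈ map ∣_∣ L
  attained k≤ oddk = let Y , ∣Y∣≡k = subsetOfSize k≤ in
    subst (_∈ map ∣_∣ L) ∣Y∣≡k (∈-map⁺ ∣_∣ (Equivalence.from (L⇔q {Y}) (trans (cong odd ∣Y∣≡k) oddk)))

-- Counting subsets by parity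

length-bfilter-allSubsets : ∀ {n} (q : Subset (suc n) → Bool) →
  length (bfilter q (allSubsets (suc n))) ≡
    length (bfilter (q ∘ (true ∷_)) (allSubsets n)) + length (bfilter (q ∘ (false ∷_)) (allSubsets n))
length-bfilter-allSubsets {n} q = begin
  length (bfilter q (map (true ∷_) S ++ map (false ∷_) S))
    ≡⟨ cong length (bfilter-++ q (map (true ∷_) S) (map (false ∷_) S)) ⟩
  length (bfilter q (map (true ∷_) S) ++ bfilter q (map (false ∷_) S))
    ≡⟨ length-++ (bfilter q (map (true ∷_) S)) ⟩
  length (bfilter q (map (true ∷_) S)) + length (bfilter q (map (false ∷_) S))
    ≡⟨ cong₂ _+_ (length-bfilter-map (true ∷_)) (length-bfilter-map (false ∷_)) ⟩
  length (bfilter (q ∘ (true ∷_)) S) + length (bfilter (q ∘ (false ∷_)) S) ∎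
  where
  open ≡-Reasoning
  S : List (Subset n)
  S = allSubsets n
  length-bfilter-map : ∀ f → length (bfilter q (map f S)) ≡ length (bfilter (q ∘ f) S)
  length-bfilter-map f = trans (cong length (bfilter-map q f S)) (length-map f (bfilter (q ∘ f) S))

length-bfilter-parity : ∀ b n → length (bfilter (λ X → b xor odd ∣ X ∣) (allSubsets (suc n))) ≡ 2 ^ n
length-bfilter-parity b n = begin
  length (bfilter q (allSubsets (suc n)))
    ≡⟨ length-bfilter-allSubsets {n} q ⟩
  length (bfilter (λ X → b xor odd ∣ true ∷ X ∣) S) + length (bfilter q S)
    ≡⟨ cong (λ xs → length xs + length (bfilter q S))
            (bfilter-cong (λ X → sym (not-distribʳ-xor b (odd ∣ X ∣))) S) ⟩
  length (bfilter (not ∘ q) S) + length (bfilter q S)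
    ≡⟨ +-comm (length (bfilter (not ∘ q) S)) _ ⟩
  length (bfilter q S) + length (bfilter (not ∘ q) S)
    ≡⟨ length-bfilter-∁ q S ⟩
  length S
    ≡⟨ length-allSubsets n ⟩
  2 ^ n ∎
  where
  open ≡-Reasoning
  S : List (Subset n)
  S = allSubsets n
  q : ∀ {m} → Subset m → Bool
  q X = b xor odd ∣ X ∣

length-bfilter-byParity : ∀ (g : Bool → Bool) n →
  length (bfilter (λ X → g (odd ∣ X ∣)) (allSubsets (suc n))) ≡
    (if g true then 2 ^ n else 0) + (if g false then 2 ^ n else 0)
length-bfilter-byParity g n = trans (length-bfilter-∘ g (λ X → odd ∣ X ∣) (allSubsets (suc n)))
  (cong₂ _+_ (cong (λ c → if g true then c else 0) (length-bfilter-parity false n))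
             (cong (λ c → if g false then c else 0) (length-bfilter-parity true n)))

does-≟-sym : ∀ m n → does (m ≟ n) ≡ does (n ≟ m)
does-≟-sym m n with m ≟ n
... | yes refl = refl
... | no m≢n = trans (dec-false (m ≟ n) m≢n) (sym (dec-false (n ≟ m) (m≢n ∘ sym)))

mono≡ : ∀ c d k → mono c d k ≡ (if does (d ≟ k) then c else 0)
mono≡ c d k = cong (λ b → if b then c else 0) (does-≟-sym k d)

if-+ : ∀ b x y → (if b then x else 0) + (if b then y else 0) ≡ (if b then x + y else 0)
if-+ true x y = refl
if-+ false x y = refl

-- The delta-matroid of even sets

∈-feasibleD : ∀ {n} (C : Mat n) → (∀ X → nonsingular C X ≡ not (odd ∣ X ∣)) →
  ∀ {X} → X ∈ feasibleD C ⇔ odd ∣ X ∣ ≡ false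
∈-feasibleD {n} C nonsingular≡ {X} = mk⇔
  (λ X∈ → not-injective (trans (sym (nonsingular≡ X)) (∈-bfilter⁻ (nonsingular C) (allSubsets n) X∈)))
  (λ even → ∈-bfilter⁺ (nonsingular C) (∈-allSubsets X) (trans (nonsingular≡ X) (cong not even)))

module EvenSets {n : ℕ} (F : List (Subset (suc n))) (F⇔even : ∀ {X} → X ∈ F ⇔ odd ∣ X ∣ ≡ false) where

  ∈-twist : ∀ A {Y} → Y ∈ twist F A ⇔ odd ∣ Y ∣ ≡ odd ∣ A ∣
  ∈-twist A = mk⇔ to from
    where
    open ≡-Reasoning
    to : ∀ {Y} → Y ∈ twist F A → odd ∣ Y ∣ ≡ odd ∣ A ∣
    to Y∈ with ∈-map⁻ (A Δ_) Y∈
    ... | X , X∈F , refl = begin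
      odd ∣ A Δ X ∣           ≡⟨ odd-∣Δ∣ A X ⟩
      odd ∣ A ∣ xor odd ∣ X ∣ ≡⟨ cong (odd ∣ A ∣ xor_) (Equivalence.to F⇔even X∈F) ⟩
      odd ∣ A ∣ xor false     ≡⟨ xor-identityʳ (odd ∣ A ∣) ⟩
      odd ∣ A ∣               ∎
    from : ∀ {Y} → odd ∣ Y ∣ ≡ odd ∣ A ∣ → Y ∈ twist F A
    from {Y} oddY = subst (_∈ twist F A) (Δ-cancelˡ A Y) (∈-map⁺ (A Δ_) (Equivalence.from F⇔even
      (trans (odd-∣Δ∣ A Y) (Equivalence.from (xor≡false⇔≡ (odd ∣ A ∣) (odd ∣ Y ∣)) oddY))))

  twistPoly-byParity : (w : Bool → ℕ) →
    (∀ q → largestOfParity (suc n) q ∸ smallestOfParity q ≡ w q) → ∀ k →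
    twistPoly F k ≡ (if does (w true ≟ k) then 2 ^ n else 0) + (if does (w false ≟ k) then 2 ^ n else 0)
  twistPoly-byParity w width≡w k =
    trans (cong length (bfilter-cong (λ A → cong (λ d → does (d ≟ k)) (width-twist A)) (allSubsets (suc n))))
          (length-bfilter-byParity (λ q → does (w q ≟ k)) n)
    where
    width-twist : ∀ A → width (twist F A) ≡ w (odd ∣ A ∣)
    width-twist A = trans (width-parityClass (twist F A) (odd ∣ A ∣) (∈-twist A)) (width≡w (odd ∣ A ∣))

  twistPoly-odd : odd (suc n) ≡ true → ∀ k → twistPoly F k ≡ mono (2 ^ suc n) n k
  twistPoly-odd odd-v k = begin
    twistPoly F k
      ≡⟨ twistPoly-byParity (λ _ → n) width≡n k ⟩
    (if does (n ≟ k) then 2 ^ n else 0) + (if does (n ≟ k) then 2 ^ n else 0)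
      ≡⟨ if-+ (does (n ≟ k)) (2 ^ n) (2 ^ n) ⟩
    (if does (n ≟ k) then 2 ^ n + 2 ^ n else 0)
      ≡⟨ cong (λ c → if does (n ≟ k) then 2 ^ n + c else 0) (sym (+-identityʳ (2 ^ n))) ⟩
    (if does (n ≟ k) then 2 ^ suc n else 0)
      ≡⟨ sym (mono≡ (2 ^ suc n) n k) ⟩
    mono (2 ^ suc n) n k ∎
    where
    open ≡-Reasoning
    even-n : odd n ≡ false
    even-n = not-injective odd-v
    width≡n : ∀ q → largestOfParity (suc n) q ∸ smallestOfParity q ≡ n
    width≡n true rewrite even-n = refl
    width≡n false rewrite even-n = refl

  twistPoly-even : odd (suc n) ≡ false → ∀ k →
    twistPoly F k ≡ (mono (2 ^ n) (suc n) ⊕ mono (2 ^ n) (n ∸ 1)) k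
  twistPoly-even even-v k = begin
    twistPoly F k
      ≡⟨ twistPoly-byParity w width≡w k ⟩
    (if does (n ∸ 1 ≟ k) then 2 ^ n else 0) + (if does (suc n ≟ k) then 2 ^ n else 0)
      ≡⟨ +-comm (if does (n ∸ 1 ≟ k) then 2 ^ n else 0) _ ⟩
    (if does (suc n ≟ k) then 2 ^ n else 0) + (if does (n ∸ 1 ≟ k) then 2 ^ n else 0)
      ≡⟨ sym (cong₂ _+_ (mono≡ (2 ^ n) (suc n) k) (mono≡ (2 ^ n) (n ∸ 1) k)) ⟩
    mono (2 ^ n) (suc n) k + mono (2 ^ n) (n ∸ 1) k ∎
    where
    open ≡-Reasoning
    odd-n : odd n ≡ true
    odd-n = not-injective even-v
    w : Bool → ℕ
    w q = if q then n ∸ 1 else suc n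
    width≡w : ∀ q → largestOfParity (suc n) q ∸ smallestOfParity q ≡ w q
    width≡w true rewrite odd-n = refl
    width≡w false rewrite odd-n = refl

proposition2 : (v : ℕ) → 1 ≤ v → (C : Mat v)
    → (∀ u w → C u w ≡ C w u)
    → (∀ u → C u u ≡ false)
    → (∀ u w → u ≢ w → C u w ≡ true)
    → (¬ (2 ∣ v) → ∀ k → twistPoly (feasibleD C) k ≡ mono (2 ^ v) (v ∸ 1) k)
      × (2 ∣ v → ∀ k → twistPoly (feasibleD C) k ≡ (mono (2 ^ (v ∸ 1)) v ⊕ mono (2 ^ (v ∸ 1)) (v ∸ 2)) k)
proposition2 v@(suc _) _ C _ C-diag C-offDiag =
  (λ ¬2∣v → twistPoly-odd (¬2∣⇒odd≡true v ¬2∣v)) , (λ 2∣v → twistPoly-even (2∣⇒odd≡false 2∣v))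
  where
  open EvenSets (feasibleD C) (∈-feasibleD C (MinorsOfJ-I.nonsingular≡even C C-diag C-offDiag))
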